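{- Let $F(X,Y)$ be a CNF formula over disjoint variable sets $X,Y$, let $X'\subseteq X$ be redundant in $F$, and let $X''$ be a non-empty subset of $X'$. Then $X''$ is redundant in $F$.
   Context: A point is a complete assignment to $X\cup Y$. For $Z'\subseteq X\cup Y$, a clause is a $Z'$-clause if it contains a variable of $Z'$, and a non-$Z'$-clause otherwise. A point $\boldsymbol{p}$ is a $Z'$-boundary point of $F$ if $F(\boldsymbol{p})=0$, every clause of $F$ falsified by $\boldsymbol{p}$ is a $Z'$-clause, and this fails for every proper subset of $Z'$. $\boldsymbol{p}$ is a $Z'$-removable boundary point of $F$ if it is a $Z''$-boundary point for some $Z''\subseteq Z'$ and some clause falsified by $\boldsymbol{p}$ is a non-$Z'$-clause implied by the conjunction of the $Z'$-clauses of $F$. A set $W\subseteq X$ is redundant in $F$ if no point is both a $W'$-boundary point of $F$ for some $W'\subseteq W$ and an $X$-removable boundary point of $F$. -}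

module Defs where

open import Data.Nat using (ℕ)
open import Data.Bool using (Bool; not)
open import Data.Fin using (Fin)
open import Data.Fin.Subset using (Subset; _∈_; _∉_; _⊆_)
open import Data.List using (List)
open import Data.List.Relation.Unary.All using (All)
open import Data.List.Relation.Unary.Any using (Any)
import Data.List.Membership.Propositional as M
open import Data.Product using (Σ; _×_; ∃)
open import Relation.Binary.PropositionalEquality using (_≡_; _≢_)
open import Relation.Nullary using (¬_)

-- Variables are Fin n.  The variable set X is a subset of Fin n and
-- Y is its complement, so X, Y are disjoint and X ∪ Y = all variables.

record Literal (n : ℕ) : Set where
  constructor lit
  field
    var  : Fin n
    sign : Bool
open Literal public

Clause : ℕ → Set
Clause n = List (Literal n)

CNF : ℕ → Set
CNF n = List (Clause n)

Point : ℕ → Set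
Point n = Fin n → Bool

module _ {n : ℕ} where
  open M using () renaming (_∈_ to _∈ₗ_)

  litTrue : Point n → Literal n → Set
  litTrue p l = p (var l) ≡ sign l

  clauseSat : Point n → Clause n → Set
  clauseSat p C = Any (litTrue p) C

  clauseFalsified : Point n → Clause n → Set
  clauseFalsified p C = All (λ l → p (var l) ≡ not (sign l)) C

  Falsifies : Point n → CNF n → Set
  Falsifies p F = Any (clauseFalsified p) F

  IsZClause : Subset n → Clause n → Set
  IsZClause Z C = Any (λ l → var l ∈ Z) C

  FalsifiedAreZ : CNF n → Subset n → Point n → Set
  FalsifiedAreZ F Z p = ∀ C → C ∈ₗ F → clauseFalsified p C → IsZClause Z C

  _⊂_ : Subset n → Subset n → Set
  A ⊂ B = A ⊆ B × A ≢ B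

  IsBoundary : CNF n → Subset n → Point n → Set
  IsBoundary F Z p =
    Falsifies p F × FalsifiedAreZ F Z p ×
    (∀ Z' → Z' ⊂ Z → ¬ FalsifiedAreZ F Z' p)

  ZClausesImply : CNF n → Subset n → Clause n → Set
  ZClausesImply F Z C =
    ∀ (q : Point n) → (∀ D → D ∈ₗ F → IsZClause Z D → clauseSat q D) → clauseSat q C

  IsRemovableBoundary : CNF n → Subset n → Point n → Set
  IsRemovableBoundary F Z p =
    Σ (Subset n) (λ Z'' → Z'' ⊆ Z × IsBoundary F Z'' p) ×
    Σ (Clause n) (λ C → C ∈ₗ F × clauseFalsified p C × ¬ IsZClause Z C × ZClausesImply F Z C)

  Redundant : CNF n → Subset n → Subset n → Set
  Redundant F X W =
    W ⊆ X ×
    (∀ (p : Point n) → ¬ (Σ (Subset n) (λ W' → W' ⊆ W × IsBoundary F W' p) × IsRemovableBoundary F X p))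

{-# OPTIONS --safe #-}
module Submission where

open import Defs
open import Data.Nat using (ℕ)
open import Data.Fin.Subset using (Subset; _⊆_; Nonempty)
open import Data.Product using (_,_)

Redundant-antitone : ∀ {n} (F : CNF n) (X : Subset n) {V W : Subset n} →
                     V ⊆ W → Redundant F X W → Redundant F X V
Redundant-antitone F X V⊆W (W⊆X , noCommonPoint) =
  (λ x∈V → W⊆X (V⊆W x∈V)) ,
  (λ p ((V' , V'⊆V , boundary) , removable) →
     noCommonPoint p ((V' , (λ x∈V' → V⊆W (V'⊆V x∈V')) , boundary) , removable))

lemma4 : ∀ {n : ℕ} (F : CNF n) (X X' X'' : Subset n) → Redundant F X X' → X'' ⊆ X' → Nonempty X'' → Redundant F X X''
lemma4 F X X' X'' X'-redundant X''⊆X' _ = Redundant-antitone F X X''⊆X' X'-redundant
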